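{- Let $s\ge2$ be an integer. In $\mathrm{Sym}(4s)$ let $a=(2s-1,2s)(4s-1,4s)$, $b=(1,3,5,\dots,4s-1,2,4,6,\dots,4s)$, $R=\langle a,b\rangle$ and $\Gamma_s=\mathrm{Cay}(R,\{ab,b\})$. Let $h=(1,2)$, $g=(1,3,5,\dots,4s-1)(2,4,6,\dots,4s)$, $G=\langle h,g\rangle$ and $H=\langle h,h^g,h^{g^2},\dots,h^{g^{s-1}}\rangle$. Then $\Gamma_s\cong\mathrm{Cos}(G,H,HgH)$.
   Context: Permutations are composed left to right (the product $xy$ means first $x$, then $y$), and $x^y=y^{ -1}xy$. For a finite group $R$ and nonempty $S\subseteq R\setminus\{1\}$, $\mathrm{Cay}(R,S)$ is the digraph with vertex set $R$ and $x\to y$ iff $yx^{ -1}\in S$. For a subgroup $H$ of a finite group $G$ and a subset $D\subseteq G\setminus H$ that is a union of double cosets of $H$, the coset digraph $\mathrm{Cos}(G,H,D)$ has as vertex set the set of right cosets of $H$ in $G$, with $Hx\to Hy$ iff $yx^{ -1}\in D$. -}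

module Defs where

open import Level using (0ℓ)
open import Data.Nat using (ℕ; zero; suc; _+_; _*_; _∸_; _≤_; _<_; NonZero; >-nonZero; s≤s; z≤n)
open import Data.Nat.Properties using (≤-trans; m≤n*m)
open import Data.Nat.DivMod using (_mod_)
open import Data.Fin using (Fin)
open import Data.Fin.Permutation using (Permutation′; _⟨$⟩ʳ_; _∘ₚ_; flip; transpose)
import Data.Fin.Permutation as P
open import Data.List using (List; []; _∷_; _++_; applyUpTo)
open import Data.Product using (Σ; ∃; _×_; _,_; proj₁)
open import Data.Sum using (_⊎_)
open import Relation.Binary.PropositionalEquality using (_≡_)
open import Function.Bundles using (_⇔_)
open import Data.List.Membership.Propositional using (_∈_)

-- Permutations of Fin n (point k of {1,…,n} is the element k-1 of Fin n).

Perm : ℕ → Set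
Perm = Permutation′

module _ {n : ℕ} where

  infix 4 _≈_
  _≈_ : Perm n → Perm n → Set
  x ≈ y = ∀ i → x ⟨$⟩ʳ i ≡ y ⟨$⟩ʳ i

  -- product, composed left to right: (x · y) i = y (x i)
  infixl 7 _·_
  _·_ : Perm n → Perm n → Perm n
  x · y = x ∘ₚ y

  e : Perm n
  e = P.id

  _⁻¹ : Perm n → Perm n
  x ⁻¹ = flip x

  _^_ : Perm n → Perm n → Perm n
  x ^ y = (y ⁻¹) · x · y

  pow : Perm n → ℕ → Perm n
  pow x zero = e
  pow x (suc k) = pow x k · x

  -- the cycle (c₁,c₂,…,c_k) : c₁ ↦ c₂ ↦ … ↦ c_k ↦ c₁
  -- (realised as (c₁,c₂)(c₁,c₃)…(c₁,c_k), composed left to right)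
  cycle : List (Fin n) → Perm n
  cycle [] = e
  cycle (x ∷ []) = e
  cycle (x ∷ y ∷ rest) = transpose x y · cycle (x ∷ rest)

  data ⟨_⟩ (X : List (Perm n)) : Perm n → Set where
    gen  : ∀ {x} → x ∈ X → ⟨ X ⟩ x
    one  : ⟨ X ⟩ e
    mul  : ∀ {x y} → ⟨ X ⟩ x → ⟨ X ⟩ y → ⟨ X ⟩ (x · y)
    inv  : ∀ {x} → ⟨ X ⟩ x → ⟨ X ⟩ (x ⁻¹)
    resp : ∀ {x y} → x ≈ y → ⟨ X ⟩ x → ⟨ X ⟩ y

-- Digraphs on a vertex type with an equality relation (vertices of a
-- coset digraph are cosets, represented by elements of G up to Hx = Hy).

record Digraph : Set₁ where
  field
    V    : Set
    _≈ᵥ_ : V → V → Set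
    _⟶_  : V → V → Set

record _≅_ (Γ Δ : Digraph) : Set where
  private
    module Γ = Digraph Γ
    module Δ = Digraph Δ
  field
    to       : Γ.V → Δ.V
    from     : Δ.V → Γ.V
    to-cong  : ∀ {x y} → x Γ.≈ᵥ y → to x Δ.≈ᵥ to y
    from-cong : ∀ {x y} → x Δ.≈ᵥ y → from x Γ.≈ᵥ from y
    from-to  : ∀ x → from (to x) Γ.≈ᵥ x
    to-from  : ∀ y → to (from y) Δ.≈ᵥ y
    arcs     : ∀ x y → (x Γ.⟶ y) ⇔ (to x Δ.⟶ to y)

module _ {n : ℕ} where

  Cay : (R S : Perm n → Set) → Digraph
  Cay R S = record
    { V    = Σ (Perm n) R
    ; _≈ᵥ_ = λ x y → proj₁ x ≈ proj₁ y
    ; _⟶_  = λ x y → S (proj₁ y · (proj₁ x) ⁻¹)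
    }

  RightCoset : (H : Perm n → Set) → Perm n → Perm n → Set
  RightCoset H x z = ∃ λ h → H h × z ≈ h · x

  Cos : (G H D : Perm n → Set) → Digraph
  Cos G H D = record
    { V    = Σ (Perm n) G
    ; _≈ᵥ_ = λ x y → ∀ z → RightCoset H (proj₁ x) z ⇔ RightCoset H (proj₁ y) z
    ; _⟶_  = λ x y → D (proj₁ y · (proj₁ x) ⁻¹)
    }

  DoubleCoset : (H : Perm n → Set) → Perm n → Perm n → Set
  DoubleCoset H g z = ∃ λ h₁ → ∃ λ h₂ → H h₁ × H h₂ × z ≈ h₁ · g · h₂

module Construction (s : ℕ) (s≥2 : 2 ≤ s) where

  N : ℕ
  N = 4 * s

  private
    instance
      N-nonZero : NonZero N
      N-nonZero = >-nonZero (≤-trans (s≤s z≤n) (≤-trans s≥2 (m≤n*m s 4)))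

  pt : ℕ → Fin N
  pt k = (k ∸ 1) mod N

  odds evens : List (Fin N)
  odds  = applyUpTo (λ i → pt (2 * i + 1)) (2 * s)
  evens = applyUpTo (λ i → pt (2 * i + 2)) (2 * s)

  a b h g : Perm N
  a = transpose (pt (2 * s ∸ 1)) (pt (2 * s)) · transpose (pt (4 * s ∸ 1)) (pt (4 * s))
  b = cycle (odds ++ evens)
  h = transpose (pt 1) (pt 2)
  g = cycle odds · cycle evens

  R G H : Perm N → Set
  R = ⟨ a ∷ b ∷ [] ⟩
  G = ⟨ h ∷ g ∷ [] ⟩
  H = ⟨ applyUpTo (λ i → h ^ pow g i) s ⟩

  S : Perm N → Set
  S z = (z ≈ a · b) ⊎ (z ≈ b)

  Γ : Digraph
  Γ = Cay R S

  CosGHgH : Digraph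
  CosGHgH = Cos G H (DoubleCoset H g)

module Submission where

-- Number the points so that block q is {2q+1, 2q+2}.  Then h, g, a and b all lie in the wreath
-- product C₂ ≀ C_2s of sign changes and rotations of the 2s blocks: h flips block 0, g rotates,
-- b = gh rotates and flips the last block, and a flips the blocks s-1 and 2s-1.  So G is the
-- whole wreath product and H consists of the sign changes supported on the first s blocks.
-- Since a's sign vector is invariant under the half turn, R centralises bˢ, a rotation by half a
-- turn.  A sign change commuting with bˢ is half-turn invariant, so H meets the centraliser of bˢ
-- trivially, while suitable products of conjugates of a, times a power of b, show G = H R.
-- Hence R meets every right coset of H in exactly one element.  Finally, if z ∈ H g H commutes
-- with bˢ, then z b⁻¹ is a half-turn invariant sign change supported on the first s blocks and
-- the last one, so z b⁻¹ ∈ {e, a}: the arcs y x⁻¹ ∈ H g H between elements of R are exactly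
-- those with y x⁻¹ ∈ {ab, b}.

open import Defs
open import Data.Nat hiding (_^_)
open import Data.Nat.Properties
open import Data.Nat.DivMod
open import Data.Nat.Divisibility using (_∣_; divides; ∣-refl)
open import Data.Parity.Base as ℙ using (Parity; 0ℙ; 1ℙ)
import Data.Parity.Properties as ℙ
open import Data.Fin using (Fin; toℕ; fromℕ<)
import Data.Fin.Properties as Fin
open import Data.Fin.Permutation using (_⟨$⟩ʳ_; _⟨$⟩ˡ_; inverseʳ; inverseˡ; transpose)
open import Data.List using ([]; _∷_; _++_; applyUpTo)
open import Data.List.Membership.Propositional using (_∈_)
open import Data.List.Membership.Propositional.Properties using (∈-applyUpTo⁺; ∈-applyUpTo⁻)
open import Data.List.Relation.Unary.Any using (here; there)
open import Data.Product using (_×_; _,_; proj₁; proj₂; ∃; ∃₂)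
open import Data.Sum using (inj₁; inj₂)
open import Data.Bool using (if_then_else_)
open import Data.Empty using (⊥-elim)
open import Function using (_∘_; _∘′_)
open import Function.Bundles using (_⇔_; mk⇔; Equivalence)
open import Relation.Binary.PropositionalEquality hiding (resp)
open import Relation.Nullary using (yes; no; does; contradiction)
open import Relation.Nullary.Decidable using (dec-true; dec-false)

-- Blocks of points

encode : ℕ → Parity → ℕ
encode zero    0ℙ = 0
encode zero    1ℙ = 1
encode (suc q) p  = suc (suc (encode q p))

⌊encode/2⌋ : ∀ q p → ⌊ encode q p /2⌋ ≡ q
⌊encode/2⌋ zero    0ℙ = refl
⌊encode/2⌋ zero    1ℙ = refl
⌊encode/2⌋ (suc q) p  = cong suc (⌊encode/2⌋ q p)

parity-encode : ∀ q p → parity (encode q p) ≡ p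
parity-encode zero    0ℙ = refl
parity-encode zero    1ℙ = refl
parity-encode (suc q) p  = parity-encode q p

encode-⌊/2⌋-parity : ∀ n → encode ⌊ n /2⌋ (parity n) ≡ n
encode-⌊/2⌋-parity 0             = refl
encode-⌊/2⌋-parity 1             = refl
encode-⌊/2⌋-parity (suc (suc n)) = cong (suc ∘′ suc) (encode-⌊/2⌋-parity n)

encode-injective : ∀ {q q′ p p′} → encode q p ≡ encode q′ p′ → q ≡ q′ × p ≡ p′
encode-injective {q} {q′} {p} {p′} eq =
  trans (sym (⌊encode/2⌋ q p)) (trans (cong ⌊_/2⌋ eq) (⌊encode/2⌋ q′ p′)) ,
  trans (sym (parity-encode q p)) (trans (cong parity eq) (parity-encode q′ p′))

encode-0ℙ : ∀ q → encode q 0ℙ ≡ 2 * q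
encode-0ℙ zero    = refl
encode-0ℙ (suc q) = trans (cong (suc ∘′ suc) (encode-0ℙ q)) (sym (*-suc 2 q))

encode-1ℙ : ∀ q → encode q 1ℙ ≡ suc (encode q 0ℙ)
encode-1ℙ zero    = refl
encode-1ℙ (suc q) = cong (suc ∘′ suc) (encode-1ℙ q)

encode-< : ∀ {q m} p → q < m → encode q p < 2 * m
encode-< {zero}  {suc m} 0ℙ _         = z<s
encode-< {zero}  {suc m} 1ℙ _         = subst (1 <_) (sym (*-suc 2 m)) (s<s z<s)
encode-< {suc q} {suc m} p  (s≤s q<m) = subst (encode (suc q) p <_) (sym (*-suc 2 m)) (s<s (s<s (encode-< p q<m)))

⌊/2⌋-< : ∀ {n m} → n < 2 * m → ⌊ n /2⌋ < m
⌊/2⌋-< {_}           {zero}  ()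
⌊/2⌋-< {0}           {suc m} _  = z<s
⌊/2⌋-< {1}           {suc m} _  = z<s
⌊/2⌋-< {suc (suc n)} {suc m} n<2m rewrite *-suc 2 m = s<s (⌊/2⌋-< (s<s⁻¹ (s<s⁻¹ n<2m)))

-- Rotations of ℤ/M

module Rotation (M : ℕ) .{{_ : NonZero M}} where

  -- rotation by k on ℤ/M is undone by rotation by (M - 1) k
  neg : ℕ → ℕ
  neg k = (M ∸ 1) * k

  M∣k+neg-k : ∀ k → M ∣ k + neg k
  M∣k+neg-k k = divides k (begin
      k + (M ∸ 1) * k ≡⟨ cong (k +_) (*-comm (M ∸ 1) k) ⟩
      k + k * (M ∸ 1) ≡⟨ sym (*-suc k (M ∸ 1)) ⟩
      k * suc (M ∸ 1) ≡⟨ cong (k *_) (suc-pred M) ⟩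
      k * M           ∎)
    where open ≡-Reasoning

  [m%n+k]%n≡[m+k]%n : ∀ m k → (m % M + k) % M ≡ (m + k) % M
  [m%n+k]%n≡[m+k]%n m k = begin
      (m % M + k) % M           ≡⟨ %-distribˡ-+ (m % M) k M ⟩
      (m % M % M + k % M) % M   ≡⟨ cong (λ t → (t + k % M) % M) (m%n%n≡m%n m M) ⟩
      (m % M + k % M) % M       ≡⟨ sym (%-distribˡ-+ m k M) ⟩
      (m + k) % M               ∎
    where open ≡-Reasoning

  rotate-assoc : ∀ q k l → ((q + k) % M + l) % M ≡ (q + (k + l)) % M
  rotate-assoc q k l = trans ([m%n+k]%n≡[m+k]%n (q + k) l) (cong (_% M) (+-assoc q k l))

  rotate-neg : ∀ q k → (q + (k + neg k)) % M ≡ q % M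
  rotate-neg q k = %-remove-+ʳ q (M∣k+neg-k k)

  rotate-back : ∀ {q} t → q < M → ((q + t) % M + neg t) % M ≡ q
  rotate-back {q} t q<M = trans (rotate-assoc q t (neg t)) (trans (rotate-neg q t) (m<n⇒m%n≡m q<M))

  rotate-injective : ∀ {q j} t → q < M → j < M → (q + t) % M ≡ (j + t) % M → q ≡ j
  rotate-injective {q} {j} t q<M j<M eq =
    trans (sym (rotate-back t q<M)) (trans (cong (λ x → (x + neg t) % M) eq) (rotate-back t j<M))

  rotate-cong : ∀ q {k l} → k % M ≡ l % M → (q + k) % M ≡ (q + l) % M
  rotate-cong q {k} {l} k≡l = begin
      (q + k) % M             ≡⟨ %-distribˡ-+ q k M ⟩
      (q % M + k % M) % M     ≡⟨ cong (λ t → (q % M + t) % M) k≡l ⟩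
      (q % M + l % M) % M     ≡⟨ %-distribˡ-+ q l M ⟨
      (q + l) % M             ∎
    where open ≡-Reasoning

  rotate-zero : ∀ {q} → q < M → (q + 0) % M ≡ q
  rotate-zero {q} q<M = trans (cong (_% M) (+-identityʳ q)) (m<n⇒m%n≡m q<M)

-- Transpositions and cycles

module _ {n : ℕ} where

  transpose-left : ∀ (i j : Fin n) → transpose i j ⟨$⟩ʳ i ≡ j
  transpose-left i j rewrite dec-true (i Fin.≟ i) refl = refl

  transpose-right : ∀ (i j : Fin n) → transpose i j ⟨$⟩ʳ j ≡ i
  transpose-right i j with j Fin.≟ i
  ... | yes j≡i = j≡i
  ... | no _ rewrite dec-true (j Fin.≟ j) refl = refl

  transpose-other : ∀ {i j k : Fin n} → k ≢ i → k ≢ j → transpose i j ⟨$⟩ʳ k ≡ k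
  transpose-other {i} {j} {k} k≢i k≢j rewrite dec-false (k Fin.≟ i) k≢i | dec-false (k Fin.≟ j) k≢j = refl

  InjectiveBelow : ℕ → (ℕ → Fin n) → Set
  InjectiveBelow m f = ∀ {i j} → i < m → j < m → f i ≡ f j → i ≡ j

  -- cycle (f 0 ∷ f 1 ∷ rest) is transpose (f 0) (f 1) followed by the cycle of delete₁ f
  delete₁ : (ℕ → Fin n) → ℕ → Fin n
  delete₁ f zero    = f zero
  delete₁ f (suc i) = f (suc (suc i))

  delete₁-injective : ∀ {m f} → InjectiveBelow (suc (suc m)) f → InjectiveBelow (suc m) (delete₁ f)
  delete₁-injective inj {zero}  {zero}  _ _ _ = refl
  delete₁-injective inj {zero}  {suc j} _ j<m = ⊥-elim ∘ 1+n≢0 ∘ sym ∘ inj z<s (s≤s j<m)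
  delete₁-injective inj {suc i} {zero}  i<m _ = ⊥-elim ∘ 1+n≢0 ∘ inj (s≤s i<m) z<s
  delete₁-injective inj {suc i} {suc j} i<m j<m eq = suc-injective (inj (s≤s i<m) (s≤s j<m) eq)

  cycle-fix : ∀ m (f : ℕ → Fin n) {p} → (∀ {i} → i < m → p ≢ f i) → cycle (applyUpTo f m) ⟨$⟩ʳ p ≡ p
  cycle-fix zero          f p∉ = refl
  cycle-fix (suc zero)    f p∉ = refl
  cycle-fix (suc (suc m)) f p∉ =
    trans (cong (cycle (applyUpTo (delete₁ f) (suc m)) ⟨$⟩ʳ_) (transpose-other (p∉ z<s) (p∉ (s≤s z<s))))
          (cycle-fix (suc m) (delete₁ f) p∉′)
    where
    p∉′ : ∀ {i} → i < suc m → _ ≢ delete₁ f i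
    p∉′ {zero}  _   = p∉ z<s
    p∉′ {suc i} i<m = p∉ (s≤s i<m)

  cycle-succ : ∀ m (f : ℕ → Fin n) → InjectiveBelow m f → ∀ {i} → suc i < m →
               cycle (applyUpTo f m) ⟨$⟩ʳ f i ≡ f (suc i)
  cycle-succ (suc zero) f inj (s≤s ())
  cycle-succ (suc (suc m)) f inj {zero} _ =
    trans (cong (cycle (applyUpTo (delete₁ f) (suc m)) ⟨$⟩ʳ_) (transpose-left (f 0) (f 1)))
          (cycle-fix (suc m) (delete₁ f) f1∉)
    where
    f1∉ : ∀ {i} → i < suc m → f 1 ≢ delete₁ f i
    f1∉ {zero}  _   = 1+n≢0 ∘ inj (s≤s z<s) z<s
    f1∉ {suc i} i<m = 1+n≢0 ∘ sym ∘ suc-injective ∘ inj (s≤s z<s) (s≤s i<m)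
  cycle-succ (suc (suc m)) f inj {suc zero} 2<m =
    trans (cong (cycle (applyUpTo (delete₁ f) (suc m)) ⟨$⟩ʳ_) (transpose-right (f 0) (f 1)))
          (cycle-succ (suc m) (delete₁ f) (delete₁-injective inj) (s≤s⁻¹ 2<m))
  cycle-succ (suc (suc m)) f inj {suc (suc i)} i<m =
    trans (cong (cycle (applyUpTo (delete₁ f) (suc m)) ⟨$⟩ʳ_)
                (transpose-other (1+n≢0 ∘ inj (<⇒≤ i<m) z<s) (1+n≢0 ∘ suc-injective ∘ inj (<⇒≤ i<m) (s≤s z<s))))
          (cycle-succ (suc m) (delete₁ f) (delete₁-injective inj) (s≤s⁻¹ i<m))

  cycle-wrap : ∀ m (f : ℕ → Fin n) → InjectiveBelow (suc m) f → cycle (applyUpTo f (suc m)) ⟨$⟩ʳ f m ≡ f 0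
  cycle-wrap zero          f inj = refl
  cycle-wrap (suc zero)    f inj = transpose-right (f 0) (f 1)
  cycle-wrap (suc (suc m)) f inj =
    trans (cong (cycle (applyUpTo (delete₁ f) (suc (suc m))) ⟨$⟩ʳ_)
                (transpose-other (1+n≢0 ∘ inj ≤-refl z<s) (1+n≢0 ∘ suc-injective ∘ inj ≤-refl (s≤s z<s))))
          (cycle-wrap (suc m) (delete₁ f) (delete₁-injective inj))

applyUpTo-++ : ∀ {A : Set} (f : ℕ → A) m k → applyUpTo f m ++ applyUpTo (λ i → f (m + i)) k ≡ applyUpTo f (m + k)
applyUpTo-++ f zero    k = refl
applyUpTo-++ f (suc m) k = cong (f 0 ∷_) (applyUpTo-++ (f ∘ suc) m k)

applyUpTo-cong : ∀ {A : Set} {f g : ℕ → A} m → (∀ {i} → i < m → f i ≡ g i) → applyUpTo f m ≡ applyUpTo g m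
applyUpTo-cong zero    f≗g = refl
applyUpTo-cong (suc m) f≗g = cong₂ _∷_ (f≗g z<s) (applyUpTo-cong m (f≗g ∘ s≤s))

module _ (M : ℕ) .{{_ : NonZero M}} where

  data Successor (q : ℕ) : Set where
    inner : suc q < M → Successor q
    last  : suc q ≡ M → Successor q

  successor : ∀ {q} → q < M → Successor q
  successor {q} q<M with suc q <? M
  ... | yes q+1<M = inner q+1<M
  ... | no  q+1≮M = last (≤∧≮⇒≡ q<M q+1≮M)

  [q+1]%M-inner : ∀ {q} → suc q < M → (q + 1) % M ≡ suc q
  [q+1]%M-inner {q} q+1<M = trans (cong (_% M) (+-comm q 1)) (m<n⇒m%n≡m q+1<M)

  [q+1]%M-last : ∀ {q} → suc q ≡ M → (q + 1) % M ≡ 0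
  [q+1]%M-last {q} q+1≡M = trans (cong (_% M) (trans (+-comm q 1) q+1≡M)) (n%n≡0 M)

  cycle-rotate : ∀ {n} (f : ℕ → Fin n) → InjectiveBelow M f → ∀ {q} → q < M →
                 cycle (applyUpTo f M) ⟨$⟩ʳ f q ≡ f ((q + 1) % M)
  cycle-rotate f inj {q} q<M with successor q<M
  ... | inner q+1<M = trans (cycle-succ M f inj q+1<M) (cong f (sym ([q+1]%M-inner q+1<M)))
  ... | last  refl  = trans (cycle-wrap q f inj) (cong f (sym ([q+1]%M-last refl)))

-- Subgroups, centralisers and right cosets

module _ {n : ℕ} where

  record IsSubgroup (P : Perm n → Set) : Set where
    field
      e-closed   : P e
      ·-closed   : ∀ {x y} → P x → P y → P (x · y)
      ⁻¹-closed  : ∀ {x} → P x → P (x ⁻¹)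
      ≈-closed   : ∀ {x y} → x ≈ y → P x → P y

    pow-closed : ∀ {x} → P x → ∀ k → P (pow x k)
    pow-closed px zero    = e-closed
    pow-closed px (suc k) = ·-closed (pow-closed px k) px

    conj-closed : ∀ {x y} → P x → P y → P (x ^ y)
    conj-closed px py = ·-closed (·-closed (⁻¹-closed py) px) py

  ⟨⟩-isSubgroup : ∀ X → IsSubgroup ⟨ X ⟩
  ⟨⟩-isSubgroup X = record { e-closed = one ; ·-closed = mul ; ⁻¹-closed = inv ; ≈-closed = resp }

  ⟨⟩-minimal : ∀ {X P} → IsSubgroup P → (∀ {x} → x ∈ X → P x) → ∀ {x} → ⟨ X ⟩ x → P x
  ⟨⟩-minimal P-sub X⊆P (gen x∈X)  = X⊆P x∈X
  ⟨⟩-minimal P-sub X⊆P one        = IsSubgroup.e-closed P-sub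
  ⟨⟩-minimal P-sub X⊆P (mul px py) = IsSubgroup.·-closed P-sub (⟨⟩-minimal P-sub X⊆P px) (⟨⟩-minimal P-sub X⊆P py)
  ⟨⟩-minimal P-sub X⊆P (inv px)   = IsSubgroup.⁻¹-closed P-sub (⟨⟩-minimal P-sub X⊆P px)
  ⟨⟩-minimal P-sub X⊆P (resp x≈y px) = IsSubgroup.≈-closed P-sub x≈y (⟨⟩-minimal P-sub X⊆P px)

  record Commutes (c x : Perm n) : Set where
    constructor commutes
    field commute : x · c ≈ c · x

  commutes-isSubgroup : ∀ c → IsSubgroup (Commutes c)
  commutes-isSubgroup c = record
    { e-closed  = commutes λ p → refl
    ; ·-closed  = λ {x} {y} (commutes cx) (commutes cy) → commutes λ p → trans (cy (x ⟨$⟩ʳ p)) (cong (y ⟨$⟩ʳ_) (cx p))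
    ; ⁻¹-closed = λ {x} (commutes cx) → commutes λ p →
                    trans (sym (inverseˡ x)) (cong (x ⟨$⟩ˡ_) (trans (sym (cx _)) (cong (c ⟨$⟩ʳ_) (inverseʳ x))))
    ; ≈-closed  = λ {x} {y} x≈y (commutes cx) → commutes λ p → trans (cong (c ⟨$⟩ʳ_) (sym (x≈y p))) (trans (cx p) (x≈y _))
    }

  pow-commutes : ∀ (x : Perm n) k → Commutes (pow x k) x
  pow-commutes x k = commutes (commute k)
    where
    commute : ∀ k → x · pow x k ≈ pow x k · x
    commute zero    p = refl
    commute (suc k) p = cong (x ⟨$⟩ʳ_) (commute k p)

  infixl 8 _^ℙ_
  _^ℙ_ : Perm n → Parity → Perm n
  x ^ℙ 0ℙ = e
  x ^ℙ 1ℙ = x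

  product : (ℕ → Parity) → (ℕ → Perm n) → ℕ → Perm n
  product w y zero    = e
  product w y (suc m) = product w y m · y m ^ℙ w m

  product-closed : ∀ {P : Perm n → Set} → IsSubgroup P → ∀ w y m → (∀ {j} → j < m → P (y j)) → P (product w y m)
  product-closed P-sub w y zero    y∈P = IsSubgroup.e-closed P-sub
  product-closed {P} P-sub w y (suc m) y∈P = IsSubgroup.·-closed P-sub (product-closed P-sub w y m (y∈P ∘ m<n⇒m<1+n)) (power (w m))
    where
    power : ∀ p → P (y m ^ℙ p)
    power 0ℙ = IsSubgroup.e-closed P-sub
    power 1ℙ = y∈P ≤-refl

  x≈z·y⇒x·y⁻¹≈z : ∀ {x y z : Perm n} → x ≈ z · y → x · y ⁻¹ ≈ z
  x≈z·y⇒x·y⁻¹≈z {y = y} x≈z·y p = trans (cong (y ⟨$⟩ˡ_) (x≈z·y p)) (inverseˡ y)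

  x·y⁻¹≈z⇒x≈z·y : ∀ {x y z : Perm n} → x · y ⁻¹ ≈ z → x ≈ z · y
  x·y⁻¹≈z⇒x≈z·y {x} {y} x·y⁻¹≈z p = trans (sym (inverseʳ y)) (cong (y ⟨$⟩ʳ_) (x·y⁻¹≈z p))

  module _ {H : Perm n → Set} (H-sub : IsSubgroup H) where
    open IsSubgroup H-sub

    rightCoset-sym : ∀ x y → RightCoset H x y → RightCoset H y x
    rightCoset-sym x y (h , h∈H , y≈h·x) = h ⁻¹ , ⁻¹-closed h∈H , λ p →
      trans (cong (x ⟨$⟩ʳ_) (sym (inverseʳ h))) (sym (y≈h·x _))

    rightCoset-trans : ∀ x y z → RightCoset H x y → RightCoset H y z → RightCoset H x z
    rightCoset-trans x y z (h , h∈H , y≈h·x) (h′ , h′∈H , z≈h′·y) = h′ · h , ·-closed h′∈H h∈H , λ p →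
      trans (z≈h′·y p) (y≈h·x _)

    rightCoset-of-member : ∀ x y → RightCoset H x y → ∀ z → RightCoset H y z ⇔ RightCoset H x z
    rightCoset-of-member x y y∈Hx z =
      mk⇔ (rightCoset-trans x y z y∈Hx) (rightCoset-trans y x z (rightCoset-sym x y y∈Hx))

  rightCoset-resp : ∀ {H : Perm n → Set} x y z → x ≈ y → RightCoset H x z → RightCoset H y z
  rightCoset-resp x y z x≈y (h , h∈H , z≈h·x) = h , h∈H , λ p → trans (z≈h·x p) (x≈y _)

-- Sign vectors

δ : ℕ → ℕ → Parity
δ i q = if does (q ≟ i) then 1ℙ else 0ℙ

δ-self : ∀ i → δ i i ≡ 1ℙ
δ-self i rewrite dec-true (i ≟ i) refl = refl

δ-other : ∀ {i q} → q ≢ i → δ i q ≡ 0ℙ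
δ-other {i} {q} q≢i rewrite dec-false (q ≟ i) q≢i = refl

δ-cong : ∀ {i q i′ q′} → (q ≡ i → q′ ≡ i′) → (q′ ≡ i′ → q ≡ i) → δ i q ≡ δ i′ q′
δ-cong {i} {q} {i′} {q′} to from with q ≟ i
... | yes refl = trans (δ-self i) (trans (sym (δ-self i′)) (cong (δ i′) (sym (to refl))))
... | no  q≢i = trans (δ-other q≢i) (sym (δ-other (q≢i ∘ from)))

δ-+ : ∀ {n q} j → n ≤ q → δ (n + j) q ≡ δ j (q ∸ n)
δ-+ {n} {q} j n≤q = δ-cong (λ q≡n+j → trans (cong (_∸ n) q≡n+j) (m+n∸m≡n n j))
                          (λ q∸n≡j → trans (sym (m+[n∸m]≡n n≤q)) (cong (n +_) q∸n≡j))

p+q+p≡q : ∀ p q → p ℙ.+ q ℙ.+ p ≡ q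
p+q+p≡q 0ℙ q  = ℙ.+-identityʳ q
p+q+p≡q 1ℙ 0ℙ = refl
p+q+p≡q 1ℙ 1ℙ = refl

p+q+q≡p : ∀ p q → p ℙ.+ q ℙ.+ q ≡ p
p+q+q≡p p q = trans (ℙ.+-assoc p q q) (trans (cong (p ℙ.+_) (ℙ.p+p≡0ℙ q)) (ℙ.+-identityʳ p))

∑ : ℕ → (ℕ → Parity) → Parity
∑ zero    f = 0ℙ
∑ (suc m) f = ∑ m f ℙ.+ f m

∑-cong : ∀ m {f g} → (∀ {j} → j < m → f j ≡ g j) → ∑ m f ≡ ∑ m g
∑-cong zero    f≗g = refl
∑-cong (suc m) f≗g = cong₂ ℙ._+_ (∑-cong m (f≗g ∘ m<n⇒m<1+n)) (f≗g ≤-refl)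

∑-sift-≥ : ∀ m (w : ℕ → Parity) {i} → m ≤ i → ∑ m (λ j → w j ℙ.* δ j i) ≡ 0ℙ
∑-sift-≥ zero    w m≤i = refl
∑-sift-≥ (suc m) w m<i rewrite ∑-sift-≥ m w (<⇒≤ m<i) | δ-other (>⇒≢ m<i) = ℙ.*-zeroʳ (w m)

∑-sift-< : ∀ m (w : ℕ → Parity) {i} → i < m → ∑ m (λ j → w j ℙ.* δ j i) ≡ w i
∑-sift-< (suc m) w {i} i<1+m with i ≟ m
... | yes refl rewrite ∑-sift-≥ m w (≤-refl {i}) | δ-self i = ℙ.*-identityʳ (w i)
... | no  i≢m  rewrite ∑-sift-< m w (≤∧≢⇒< (s≤s⁻¹ i<1+m) i≢m) | δ-other i≢m | ℙ.*-zeroʳ (w m) = ℙ.+-identityʳ (w i)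

-- The wreath product C₂ ≀ C_M

-- Realises x σ k: x sends side p of block q to side p + σ q of block q + k (mod M), i.e. x is the
-- element (σ, k) of C₂ ≀ C_M.
module Wreath (M : ℕ) .{{_ : NonZero M}} (Nn : ℕ) (Nn≡2M : Nn ≡ 2 * M) where

  open Rotation M

  Signs : Set
  Signs = ℕ → Parity

  infixl 6 _⊕_
  _⊕_ : Signs → Signs → Signs
  (σ ⊕ τ) q = σ q ℙ.+ τ q

  rot : ℕ → Signs → Signs
  rot k σ q = σ ((q + k) % M)

  act : Signs → ℕ → ℕ → ℕ
  act σ k n = encode ((⌊ n /2⌋ + k) % M) (parity n ℙ.+ σ ⌊ n /2⌋)

  record Realises (x : Perm Nn) (σ : Signs) (k : ℕ) : Set where
    constructor realises
    field apply : ∀ p → toℕ (x ⟨$⟩ʳ p) ≡ act σ k (toℕ p)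
  open Realises

  block<M : ∀ (p : Fin Nn) → ⌊ toℕ p /2⌋ < M
  block<M p = ⌊/2⌋-< (subst (toℕ p <_) Nn≡2M (Fin.toℕ<n p))

  act-encode : ∀ σ k q p → act σ k (encode q p) ≡ encode ((q + k) % M) (p ℙ.+ σ q)
  act-encode σ k q p rewrite ⌊encode/2⌋ q p | parity-encode q p = refl

  act-∘ : ∀ σ k τ l n → act τ l (act σ k n) ≡ act (σ ⊕ rot k τ) (k + l) n
  act-∘ σ k τ l n = trans (act-encode τ l _ _) (cong₂ encode (rotate-assoc ⌊ n /2⌋ k l) (ℙ.+-assoc (parity n) (σ ⌊ n /2⌋) _))

  realises-intro : ∀ {x σ k} → (∀ v q p → q < M → toℕ v ≡ encode q p → toℕ (x ⟨$⟩ʳ v) ≡ encode ((q + k) % M) (p ℙ.+ σ q)) →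
                   Realises x σ k
  realises-intro on-blocks = realises λ v → on-blocks v _ _ (block<M v) (sym (encode-⌊/2⌋-parity (toℕ v)))

  realises-· : ∀ {x σ k y τ l} → Realises x σ k → Realises y τ l → Realises (x · y) (σ ⊕ rot k τ) (k + l)
  realises-· {x} {σ} {k} {y} {τ} {l} rx ry = realises λ p →
    trans (apply ry (x ⟨$⟩ʳ p)) (trans (cong (act τ l) (apply rx p)) (act-∘ σ k τ l (toℕ p)))

  realises-resp : ∀ {x y σ k} → x ≈ y → Realises x σ k → Realises y σ k
  realises-resp x≈y rx = realises λ p → trans (cong toℕ (sym (x≈y p))) (apply rx p)

  realises-cong : ∀ {x σ k τ l} → Realises x σ k → (∀ q → q < M → σ q ≡ τ q) → k % M ≡ l % M → Realises x τ l
  realises-cong rx σ≗τ k≡l = realises λ p → trans (apply rx p)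
    (cong₂ encode (rotate-cong ⌊ toℕ p /2⌋ k≡l) (cong (parity (toℕ p) ℙ.+_) (σ≗τ _ (block<M p))))

  realises-unique : ∀ {x y σ k} → Realises x σ k → Realises y σ k → x ≈ y
  realises-unique rx ry p = Fin.toℕ-injective (trans (apply rx p) (sym (apply ry p)))

  realises-signs : ∀ {x σ k τ l} → Realises x σ k → Realises x τ l → ∀ {q} → q < M → σ q ≡ τ q
  realises-signs {x} {σ} {k} {τ} {l} rx rx′ {q} q<M = proj₂ (encode-injective (begin
      encode ((q + k) % M) (σ q)  ≡⟨ sym (act-encode σ k q 0ℙ) ⟩
      act σ k (encode q 0ℙ)      ≡⟨ cong (act σ k) (sym p≡q) ⟩
      act σ k (toℕ p)            ≡⟨ sym (apply rx p) ⟩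
      toℕ (x ⟨$⟩ʳ p)             ≡⟨ apply rx′ p ⟩
      act τ l (toℕ p)            ≡⟨ cong (act τ l) p≡q ⟩
      act τ l (encode q 0ℙ)      ≡⟨ act-encode τ l q 0ℙ ⟩
      encode ((q + l) % M) (τ q)  ∎))
    where
    open ≡-Reasoning
    q<Nn : encode q 0ℙ < Nn
    q<Nn = subst (encode q 0ℙ <_) (sym Nn≡2M) (encode-< 0ℙ q<M)
    p : Fin Nn
    p = fromℕ< q<Nn
    p≡q : toℕ p ≡ encode q 0ℙ
    p≡q = Fin.toℕ-fromℕ< q<Nn

  act-trivial : ∀ σ k n → σ ⌊ n /2⌋ ≡ 0ℙ → (⌊ n /2⌋ + k) % M ≡ ⌊ n /2⌋ → act σ k n ≡ n
  act-trivial σ k n σ≡0 fixed rewrite σ≡0 | fixed | ℙ.+-identityʳ (parity n) = encode-⌊/2⌋-parity n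

  realises-e : Realises e (λ _ → 0ℙ) 0
  realises-e = realises λ p → sym (act-trivial _ 0 (toℕ p) refl (rotate-zero (block<M p)))

  realises-⁻¹ : ∀ {x σ k} → Realises x σ k → Realises (x ⁻¹) (rot (neg k) σ) (neg k)
  realises-⁻¹ {x} {σ} {k} rx = realises λ p → sym (begin
      act τ (neg k) (toℕ p)                       ≡⟨ cong (act τ (neg k) ∘ toℕ) (sym (inverseʳ x)) ⟩
      act τ (neg k) (toℕ (x ⟨$⟩ʳ (x ⟨$⟩ˡ p)))      ≡⟨ cong (act τ (neg k)) (apply rx (x ⟨$⟩ˡ p)) ⟩
      act τ (neg k) (act σ k (toℕ (x ⟨$⟩ˡ p)))     ≡⟨ act-∘ σ k τ (neg k) _ ⟩
      act (σ ⊕ rot k τ) (k + neg k) (toℕ (x ⟨$⟩ˡ p)) ≡⟨ cancel (block<M (x ⟨$⟩ˡ p)) ⟩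
      toℕ (x ⟨$⟩ˡ p)                              ∎)
    where
    open ≡-Reasoning
    τ : Signs
    τ = rot (neg k) σ
    cancel : ∀ {n} → ⌊ n /2⌋ < M → act (σ ⊕ rot k τ) (k + neg k) n ≡ n
    cancel {n} b<M = act-trivial (σ ⊕ rot k τ) (k + neg k) n
      (trans (cong (σ ⌊ n /2⌋ ℙ.+_) (cong σ (rotate-back k b<M))) (ℙ.p+p≡0ℙ (σ ⌊ n /2⌋)))
      (trans (rotate-neg ⌊ n /2⌋ k) (m<n⇒m%n≡m b<M))

  realises-⁻¹₀ : ∀ {x σ} → Realises x σ 0 → Realises (x ⁻¹) σ 0
  realises-⁻¹₀ {σ = σ} rx = realises-cong (realises-⁻¹ rx) (λ q q<M → cong σ (trans (cong (λ t → (q + t) % M) neg0≡0) (rotate-zero q<M)))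
                                          (cong (_% M) neg0≡0)
    where
    neg0≡0 : neg 0 ≡ 0
    neg0≡0 = *-zeroʳ (M ∸ 1)

  realises-pow : ∀ {x σ} → Realises x σ 1 → ∀ k → ∃ λ τ → Realises (pow x k) τ k
  realises-pow rx zero    = _ , realises-e
  realises-pow rx (suc k) = _ , realises-cong (realises-· (proj₂ (realises-pow rx k)) rx) (λ _ _ → refl) (cong (_% M) (+-comm k 1))

  realises-^ : ∀ {x σ y τ k} → Realises x σ 0 → Realises y τ k → Realises (x ^ y) (rot (neg k) σ) 0
  realises-^ {x} {σ} {y} {τ} {k} rx ry =
    realises-cong (realises-· (realises-· (realises-⁻¹ ry) rx) ry) signs rotation
    where
    signs : ∀ q → q < M → (rot (neg k) τ ⊕ rot (neg k) σ ⊕ rot (neg k + 0) τ) q ≡ rot (neg k) σ q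
    signs q _ rewrite +-identityʳ (neg k) = p+q+p≡q (τ ((q + neg k) % M)) (σ ((q + neg k) % M))
    rotation : (neg k + 0 + k) % M ≡ 0 % M
    rotation = trans (cong (_% M) (trans (cong (_+ k) (+-identityʳ (neg k))) (+-comm (neg k) k))) (rotate-neg 0 k)

  commutes⇒periodic : ∀ {x σ c u t} → Realises x σ 0 → Realises c u t → Commutes c x →
                      ∀ {q} → q < M → σ q ≡ σ ((q + t) % M)
  commutes⇒periodic {σ = σ} {u = u} {t} rx rc (commutes x·c≈c·x) {q} q<M = ℙ.+-cancelʳ-≡ (u q) _ _ (begin
      σ q ℙ.+ u q                 ≡⟨ cong (σ q ℙ.+_) (cong u (sym (rotate-zero q<M))) ⟩
      σ q ℙ.+ u ((q + 0) % M)     ≡⟨ realises-signs (realises-resp x·c≈c·x (realises-· rx rc)) (realises-· rc rx) q<M ⟩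
      u q ℙ.+ σ ((q + t) % M)     ≡⟨ ℙ.+-comm (u q) _ ⟩
      σ ((q + t) % M) ℙ.+ u q     ∎)
    where open ≡-Reasoning

  periodic⇒commutes : ∀ {x σ c u t} → Realises x σ 0 → Realises c u t →
                      (∀ {q} → q < M → σ q ≡ σ ((q + t) % M)) → Commutes c x
  periodic⇒commutes {σ = σ} {u = u} {t} rx rc periodic =
    commutes (realises-unique (realises-cong (realises-· rx rc) signs (cong (_% M) (sym (+-identityʳ t)))) (realises-· rc rx))
    where
    signs : ∀ q → q < M → σ q ℙ.+ u ((q + 0) % M) ≡ u q ℙ.+ σ ((q + t) % M)
    signs q q<M rewrite rotate-zero q<M | periodic q<M = ℙ.+-comm _ (u q)

  δ-rotate : ∀ {i j q} t → j < M → q < M → (j + t) % M ≡ i → δ i ((q + t) % M) ≡ δ j q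
  δ-rotate {i} {j} {q} t j<M q<M j↦i with q ≟ j
  ... | yes refl = trans (cong (δ i) j↦i) (trans (δ-self i) (sym (δ-self q)))
  ... | no q≢j   = trans (δ-other (q≢j ∘ rotate-injective t q<M j<M ∘ (λ q↦i → trans q↦i (sym j↦i)))) (sym (δ-other q≢j))

  δ-rotate-back : ∀ {i q} k → i < M → q < M → δ i ((q + neg k) % M) ≡ δ ((i + k) % M) q
  δ-rotate-back k i<M q<M = δ-rotate (neg k) (m%n<n _ M) q<M (rotate-back k i<M)

  transpose-realises : ∀ {P Q : Fin Nn} {j} → toℕ P ≡ encode j 0ℙ → toℕ Q ≡ encode j 1ℙ →
                       Realises (transpose P Q) (δ j) 0
  transpose-realises {P} {Q} {j} P≡ Q≡ = realises-intro on-blocks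
    where
    on-blocks : ∀ v q p → q < M → toℕ v ≡ encode q p →
                toℕ (transpose P Q ⟨$⟩ʳ v) ≡ encode ((q + 0) % M) (p ℙ.+ δ j q)
    on-blocks v q p q<M v≡ rewrite rotate-zero q<M with q ≟ j
    on-blocks v q 0ℙ q<M v≡ | yes refl
      rewrite Fin.toℕ-injective {i = v} {P} (trans v≡ (sym P≡)) | transpose-left P Q | δ-self q = Q≡
    on-blocks v q 1ℙ q<M v≡ | yes refl
      rewrite Fin.toℕ-injective {i = v} {Q} (trans v≡ (sym Q≡)) | transpose-right P Q | δ-self q = P≡
    ... | no q≢j rewrite δ-other q≢j | ℙ.+-identityʳ p =
      trans (cong toℕ (transpose-other (λ v≡P → q≢j (proj₁ (encode-injective (trans (sym v≡) (trans (cong toℕ v≡P) P≡)))))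
                                       (λ v≡Q → q≢j (proj₁ (encode-injective (trans (sym v≡) (trans (cong toℕ v≡Q) Q≡)))))))
            v≡

  realises-^ℙ : ∀ {x σ} → Realises x σ 0 → ∀ p → Realises (x ^ℙ p) (λ q → p ℙ.* σ q) 0
  realises-^ℙ rx 0ℙ = realises-e
  realises-^ℙ rx 1ℙ = rx

  realises-product : ∀ w y m {ε : ℕ → Signs} → (∀ {j} → j < m → Realises (y j) (ε j) 0) →
                     Realises (product w y m) (λ q → ∑ m (λ j → w j ℙ.* ε j q)) 0
  realises-product w y zero    ry = realises-e
  realises-product w y (suc m) {ε} ry =
    realises-cong (realises-· (realises-product w y m (ry ∘ m<n⇒m<1+n)) (realises-^ℙ (ry ≤-refl) (w m))) signs refl
    where
    signs : ∀ q → q < M → ∑ m (λ j → w j ℙ.* ε j q) ℙ.+ (w m ℙ.* ε m ((q + 0) % M)) ≡ ∑ (suc m) (λ j → w j ℙ.* ε j q)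
    signs q q<M = cong (λ r → ∑ m (λ j → w j ℙ.* ε j q) ℙ.+ (w m ℙ.* ε m r)) (rotate-zero q<M)

  realises-/ : ∀ {x σ y τ k} → Realises x σ k → Realises y τ k → Realises (x · y ⁻¹) (σ ⊕ τ) 0
  realises-/ {σ = σ} {τ = τ} {k} rx ry =
    realises-cong (realises-· rx (realises-⁻¹ ry)) (λ q q<M → cong (λ r → σ q ℙ.+ τ r) (rotate-back k q<M)) (rotate-neg 0 k)

module Lemma3p2 (s : ℕ) (s≥2 : 2 ≤ s) where
  open Construction s s≥2

  M : ℕ
  M = 2 * s

  instance
    M-nonZero : NonZero M
    M-nonZero = >-nonZero (<-≤-trans z<s (≤-trans s≥2 (m≤n*m s 2)))
    N-nonZero : NonZero N
    N-nonZero = >-nonZero (≤-trans (s≤s z≤n) (≤-trans s≥2 (m≤n*m s 4)))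

  N≡2M : N ≡ 2 * M
  N≡2M = *-assoc 2 2 s

  open Rotation M
  open Wreath M N N≡2M

  0<s : 0 < s
  0<s = <-≤-trans z<s s≥2

  instance
    s-nonZero : NonZero s
    s-nonZero = >-nonZero 0<s

  0<M : 0 < M
  0<M = >-nonZero⁻¹ M

  M≡s+s : M ≡ s + s
  M≡s+s = cong (s +_) (+-identityʳ s)

  s<M : s < M
  s<M = subst (s <_) (sym M≡s+s) (m<m+n s 0<s)

  q+s<M : ∀ {q} → q < s → q + s < M
  q+s<M {q} q<s = subst (q + s <_) (sym M≡s+s) (+-monoˡ-< s q<s)

  [q+s]%M≡q+s : ∀ {q} → q < s → (q + s) % M ≡ q + s
  [q+s]%M≡q+s q<s = m<n⇒m%n≡m (q+s<M q<s)

  pred<self : ∀ n .{{_ : NonZero n}} → n ∸ 1 < n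
  pred<self n = subst (_≤ n) (sym (suc-pred n)) ≤-refl

  ≢pred : ∀ n .{{_ : NonZero n}} {q} → suc q < n → q ≢ n ∸ 1
  ≢pred n q+1<n q≡n∸1 = <-irrefl (trans (cong suc q≡n∸1) (suc-pred n)) q+1<n

  pred+suc : ∀ n .{{_ : NonZero n}} j → n ∸ 1 + suc j ≡ n + j
  pred+suc n j = trans (+-suc (n ∸ 1) j) (cong (_+ j) (suc-pred n))

  s∸1<M : s ∸ 1 < M
  s∸1<M = <-trans (pred<self s) s<M

  s∸1+s≡M∸1 : s ∸ 1 + s ≡ M ∸ 1
  s∸1+s≡M∸1 = cong pred (trans (cong (_+ s) (suc-pred s)) (sym M≡s+s))

  s∸1≢M∸1 : s ∸ 1 ≢ M ∸ 1
  s∸1≢M∸1 eq = <-irrefl (trans eq (sym s∸1+s≡M∸1)) (m<m+n (s ∸ 1) 0<s)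

  point : Parity → ℕ → Fin N
  point 0ℙ i = pt (2 * i + 1)
  point 1ℙ i = pt (2 * i + 2)

  toℕ-pt : ∀ {n} → n < N → toℕ (pt (suc n)) ≡ n
  toℕ-pt {n} n<N = trans (Fin.toℕ-fromℕ< _) (m<n⇒m%n≡m n<N)

  point≡pt : ∀ p i → point p i ≡ pt (suc (encode i p))
  point≡pt 0ℙ i = cong pt (trans (+-comm (2 * i) 1) (cong suc (sym (encode-0ℙ i))))
  point≡pt 1ℙ i = cong pt (trans (+-comm (2 * i) 2) (cong suc (sym (trans (encode-1ℙ i) (cong suc (encode-0ℙ i))))))

  encode<N : ∀ p {i} → i < M → encode i p < N
  encode<N p {i} i<M = subst (encode i p <_) (sym N≡2M) (encode-< p i<M)

  toℕ-point : ∀ p {i} → i < M → toℕ (point p i) ≡ encode i p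
  toℕ-point p {i} i<M = trans (cong toℕ (point≡pt p i)) (toℕ-pt (encode<N p i<M))

  point-injective : ∀ {p p′ i j} → i < M → j < M → point p i ≡ point p′ j → i ≡ j × p ≡ p′
  point-injective {p} {p′} i<M j<M eq = encode-injective (trans (sym (toℕ-point p i<M)) (trans (cong toℕ eq) (toℕ-point p′ j<M)))

  point-of : ∀ {v q p} → q < M → toℕ v ≡ encode q p → v ≡ point p q
  point-of {p = p} q<M v≡ = Fin.toℕ-injective (trans v≡ (sym (toℕ-point p q<M)))

  pt-pair : ∀ {x} → 0 < x → x ≤ M → toℕ (pt (2 * x ∸ 1)) ≡ encode (x ∸ 1) 0ℙ × toℕ (pt (2 * x)) ≡ encode (x ∸ 1) 1ℙ
  pt-pair {suc y} _ x≤M = trans (cong (toℕ ∘ pt) (trans (cong (_∸ 1) 2x≡) (encode-1ℙ y))) (toℕ-pt (encode<N 0ℙ x≤M)) ,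
                          trans (cong (toℕ ∘ pt) 2x≡) (toℕ-pt (encode<N 1ℙ x≤M))
    where
    2x≡ : 2 * suc y ≡ suc (encode y 1ℙ)
    2x≡ = sym (trans (cong suc (encode-1ℙ y)) (encode-0ℙ (suc y)))

  realises-h : Realises h (δ 0) 0
  realises-h = transpose-realises (toℕ-point 0ℙ 0<M) (toℕ-point 1ℙ 0<M)

  Vₐ : Signs
  Vₐ = δ (s ∸ 1) ⊕ δ (M ∸ 1)

  realises-a : Realises a Vₐ 0
  realises-a = realises-cong (realises-· (transpose-realises (proj₁ pair-s) (proj₂ pair-s))
                                         (transpose-realises (proj₁ pair-M) (proj₂ pair-M)))
                             (λ q q<M → cong (δ (s ∸ 1) q ℙ.+_) (cong (δ (M ∸ 1)) (rotate-zero q<M))) refl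
    where
    pair-s : toℕ (pt (2 * s ∸ 1)) ≡ encode (s ∸ 1) 0ℙ × toℕ (pt (2 * s)) ≡ encode (s ∸ 1) 1ℙ
    pair-s = pt-pair 0<s (m≤n*m s 2)
    pair-M : toℕ (pt (4 * s ∸ 1)) ≡ encode (M ∸ 1) 0ℙ × toℕ (pt (4 * s)) ≡ encode (M ∸ 1) 1ℙ
    pair-M = subst (λ n → toℕ (pt (n ∸ 1)) ≡ encode (M ∸ 1) 0ℙ × toℕ (pt n) ≡ encode (M ∸ 1) 1ℙ)
                   (sym N≡2M) (pt-pair 0<M ≤-refl)

  point-injectiveBelow : ∀ p → InjectiveBelow M (point p)
  point-injectiveBelow p i<M j<M = proj₁ ∘ point-injective {p} {p} i<M j<M

  points-disjoint : ∀ {p i j} → i < M → j < M → point p i ≢ point (p ℙ.⁻¹) j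
  points-disjoint {p} i<M j<M = ℙ.p≢p⁻¹ p ∘ proj₂ ∘ point-injective i<M j<M

  rotate-point : ∀ p {q} → q < M → cycle (applyUpTo (point p) M) ⟨$⟩ʳ point p q ≡ point p ((q + 1) % M)
  rotate-point p = cycle-rotate M (point p) (point-injectiveBelow p)

  fix-point : ∀ p {q} → q < M → cycle (applyUpTo (point (p ℙ.⁻¹)) M) ⟨$⟩ʳ point p q ≡ point p q
  fix-point p q<M = cycle-fix M (point (p ℙ.⁻¹)) (points-disjoint {p} q<M)

  realises-g : Realises g (λ _ → 0ℙ) 1
  realises-g = realises-intro on-blocks
    where
    on-blocks : ∀ v q p → q < M → toℕ v ≡ encode q p → toℕ (g ⟨$⟩ʳ v) ≡ encode ((q + 1) % M) (p ℙ.+ 0ℙ)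
    on-blocks v q 0ℙ q<M v≡ rewrite point-of q<M v≡ | rotate-point 0ℙ q<M | fix-point 0ℙ (m%n<n (q + 1) M) =
      toℕ-point 0ℙ (m%n<n (q + 1) M)
    on-blocks v q 1ℙ q<M v≡ rewrite point-of q<M v≡ | fix-point 1ℙ q<M | rotate-point 1ℙ q<M =
      toℕ-point 1ℙ (m%n<n (q + 1) M)

  -- the points in the order in which the cycle b visits them
  chain : ℕ → Fin N
  chain i with i <? M
  ... | yes _ = point 0ℙ i
  ... | no  _ = point 1ℙ (i ∸ M)

  chain-low : ∀ {i} → i < M → chain i ≡ point 0ℙ i
  chain-low {i} i<M with i <? M
  ... | yes _   = refl
  ... | no  i≮M = contradiction i<M i≮M

  chain-high : ∀ i → chain (M + i) ≡ point 1ℙ i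
  chain-high i with M + i <? M
  ... | yes M+i<M = contradiction M+i<M (≤⇒≯ (m≤m+n M i))
  ... | no  _     = cong (point 1ℙ) (m+n∸m≡n M i)

  data Segment (i : ℕ) : Set where
    first  : i < M → Segment i
    second : ∀ {j} → j < M → i ≡ M + j → Segment i

  segment : ∀ {i} → i < M + M → Segment i
  segment {i} i<2M with i <? M
  ... | yes i<M = first i<M
  ... | no  i≮M = second (+-cancelˡ-< M _ _ (subst (_< M + M) i≡ i<2M)) i≡
    where
    i≡ : i ≡ M + (i ∸ M)
    i≡ = sym (m+[n∸m]≡n (≮⇒≥ i≮M))

  chain-injective : InjectiveBelow (M + M) chain
  chain-injective i<2M j<2M eq with segment i<2M | segment j<2M
  ... | first i<M | first j<M =
    point-injectiveBelow 0ℙ i<M j<M (trans (sym (chain-low i<M)) (trans eq (chain-low j<M)))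
  ... | first i<M | second j<M refl =
    contradiction (trans (sym (chain-low i<M)) (trans eq (chain-high _))) (points-disjoint {0ℙ} i<M j<M)
  ... | second i<M refl | first j<M =
    contradiction (trans (sym (chain-low j<M)) (trans (sym eq) (chain-high _))) (points-disjoint {0ℙ} j<M i<M)
  ... | second i<M refl | second j<M refl =
    cong (M +_) (point-injectiveBelow 1ℙ i<M j<M (trans (sym (chain-high _)) (trans eq (chain-high _))))

  b≡cycle-chain : b ≡ cycle (applyUpTo chain (M + M))
  b≡cycle-chain = cong cycle (trans (cong₂ _++_ (sym (applyUpTo-cong M chain-low)) (sym (applyUpTo-cong M (λ _ → chain-high _))))
                                    (applyUpTo-++ chain M M))

  b-chain-succ : ∀ {i} → suc i < M + M → b ⟨$⟩ʳ chain i ≡ chain (suc i)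
  b-chain-succ i+1<2M rewrite b≡cycle-chain = cycle-succ (M + M) chain chain-injective i+1<2M

  b-chain-wrap : ∀ {q} → suc q ≡ M → b ⟨$⟩ʳ chain (M + q) ≡ chain 0
  b-chain-wrap {q} q+1≡M rewrite b≡cycle-chain =
    subst (λ m → cycle (applyUpTo chain m) ⟨$⟩ʳ chain (M + q) ≡ chain 0) last≡2M
          (cycle-wrap (M + q) chain (λ i<m j<m → chain-injective (≤-trans i<m (≤-reflexive last≡2M))
                                                                 (≤-trans j<m (≤-reflexive last≡2M))))
    where
    last≡2M : suc (M + q) ≡ M + M
    last≡2M = trans (sym (+-suc M q)) (cong (M +_) q+1≡M)

  realises-b : Realises b (δ (M ∸ 1)) 1
  realises-b = realises-intro on-blocks
    where
    on-blocks : ∀ v q p → q < M → toℕ v ≡ encode q p → toℕ (b ⟨$⟩ʳ v) ≡ encode ((q + 1) % M) (p ℙ.+ δ (M ∸ 1) q)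
    on-blocks v q p q<M v≡ rewrite point-of q<M v≡ with successor M q<M
    ... | inner q+1<M rewrite [q+1]%M-inner M q+1<M | δ-other (≢pred M q+1<M)
                            | ℙ.+-identityʳ p = trans (cong toℕ (b-next p)) (toℕ-point p q+1<M)
      where
      b-next : ∀ p → b ⟨$⟩ʳ point p q ≡ point p (suc q)
      b-next 0ℙ = trans (cong (b ⟨$⟩ʳ_) (sym (chain-low q<M))) (trans (b-chain-succ (<-≤-trans q+1<M (m≤m+n M M))) (chain-low q+1<M))
      b-next 1ℙ = trans (cong (b ⟨$⟩ʳ_) (sym (chain-high q)))
                  (trans (b-chain-succ (subst (_< M + M) (+-suc M q) (+-monoʳ-< M q+1<M)))
                  (trans (cong chain (sym (+-suc M q))) (chain-high (suc q))))
    ... | last q+1≡M rewrite [q+1]%M-last M q+1≡M | subst (λ j → δ j q ≡ 1ℙ) (cong pred q+1≡M) (δ-self q) =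
      trans (cong toℕ (b-wrap p)) (toℕ-point (p ℙ.+ 1ℙ) 0<M)
      where
      b-wrap : ∀ p → b ⟨$⟩ʳ point p q ≡ point (p ℙ.+ 1ℙ) 0
      b-wrap 0ℙ = trans (cong (b ⟨$⟩ʳ_) (sym (chain-low q<M)))
                  (trans (b-chain-succ (subst (_< M + M) (sym q+1≡M) (m<m+n M 0<M)))
                  (trans (cong chain (trans q+1≡M (sym (+-identityʳ M)))) (chain-high 0)))
      b-wrap 1ℙ = trans (cong (b ⟨$⟩ʳ_) (sym (chain-high q))) (trans (b-chain-wrap q+1≡M) (chain-low 0<M))

  hᵢ : ℕ → Perm N
  hᵢ i = h ^ pow g i

  realises-hᵢ : ∀ {i} → i < M → Realises (hᵢ i) (δ i) 0
  realises-hᵢ {i} i<M = realises-cong (realises-^ realises-h (proj₂ (realises-pow realises-g i)))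
                                      (λ q q<M → trans (δ-rotate-back i 0<M q<M) (cong (λ j → δ j q) (m<n⇒m%n≡m i<M))) refl

  cⱼ : ℕ → Perm N
  cⱼ j = a ^ pow b (suc j)

  realises-cⱼ : ∀ {j} → j < s → Realises (cⱼ j) (δ (s + j) ⊕ δ j) 0
  realises-cⱼ {j} j<s = realises-cong (realises-^ realises-a (proj₂ (realises-pow realises-b (suc j)))) signs refl
    where
    s∸1↦s+j : (s ∸ 1 + suc j) % M ≡ s + j
    s∸1↦s+j = trans (cong (_% M) (pred+suc s j)) (m<n⇒m%n≡m (subst (_< M) (+-comm j s) (q+s<M j<s)))
    M∸1↦j : (M ∸ 1 + suc j) % M ≡ j
    M∸1↦j = trans (cong (_% M) (pred+suc M j)) (trans (%-remove-+ˡ j ∣-refl) (m<n⇒m%n≡m (<-trans j<s s<M)))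
    signs : ∀ q → q < M → rot (neg (suc j)) Vₐ q ≡ (δ (s + j) ⊕ δ j) q
    signs q q<M = cong₂ ℙ._+_ (trans (δ-rotate-back (suc j) s∸1<M q<M) (cong (λ i → δ i q) s∸1↦s+j))
                              (trans (δ-rotate-back (suc j) (pred<self M) q<M) (cong (λ i → δ i q) M∸1↦j))

  Vₐ-periodic : ∀ {q} → q < M → Vₐ q ≡ Vₐ ((q + s) % M)
  Vₐ-periodic {q} q<M = sym (trans (cong₂ ℙ._+_ (δ-rotate s (pred<self M) q<M M∸1↦s∸1) (δ-rotate s s∸1<M q<M s∸1↦M∸1))
                                   (ℙ.+-comm (δ (M ∸ 1) q) (δ (s ∸ 1) q)))
    where
    s∸1↦M∸1 : (s ∸ 1 + s) % M ≡ M ∸ 1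
    s∸1↦M∸1 = trans ([q+s]%M≡q+s (pred<self s)) s∸1+s≡M∸1
    M∸1↦s∸1 : (M ∸ 1 + s) % M ≡ s ∸ 1
    M∸1↦s∸1 = trans (cong (λ x → (x + s) % M) (sym s∸1+s≡M∸1))
              (trans (cong (_% M) (trans (+-assoc (s ∸ 1) s s) (cong (s ∸ 1 +_) (sym M≡s+s))))
              (trans (%-remove-+ʳ (s ∸ 1) ∣-refl) (m<n⇒m%n≡m s∸1<M)))

  bˢ : Perm N
  bˢ = pow b s

  uˢ : Signs
  uˢ = proj₁ (realises-pow realises-b s)

  realises-bˢ : Realises bˢ uˢ s
  realises-bˢ = proj₂ (realises-pow realises-b s)

  R-centralises-bˢ : ∀ {x} → R x → Commutes bˢ x
  R-centralises-bˢ = ⟨⟩-minimal (commutes-isSubgroup bˢ) generators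
    where
    generators : ∀ {x} → x ∈ a ∷ b ∷ [] → Commutes bˢ x
    generators (here refl)         = periodic⇒commutes realises-a realises-bˢ Vₐ-periodic
    generators (there (here refl)) = pow-commutes b s

  InWreath : Perm N → Set
  InWreath x = ∃₂ λ σ k → Realises x σ k

  wreath-isSubgroup : IsSubgroup InWreath
  wreath-isSubgroup = record
    { e-closed  = _ , _ , realises-e
    ; ·-closed  = λ (_ , _ , rx) (_ , _ , ry) → _ , _ , realises-· rx ry
    ; ⁻¹-closed = λ (_ , _ , rx) → _ , _ , realises-⁻¹ rx
    ; ≈-closed  = λ x≈y (_ , _ , rx) → _ , _ , realises-resp x≈y rx
    }

  G⊆wreath : ∀ {x} → G x → InWreath x
  G⊆wreath = ⟨⟩-minimal wreath-isSubgroup generators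
    where
    generators : ∀ {x} → x ∈ h ∷ g ∷ [] → InWreath x
    generators (here refl)         = _ , _ , realises-h
    generators (there (here refl)) = _ , _ , realises-g

  δ0∘rotate1 : ∀ {q} → q < M → δ 0 ((q + 1) % M) ≡ δ (M ∸ 1) q
  δ0∘rotate1 q<M = δ-rotate 1 (pred<self M) q<M (trans (cong (_% M) (trans (+-comm (M ∸ 1) 1) (suc-pred M))) (n%n≡0 M))

  g·h≈b : g · h ≈ b
  g·h≈b = realises-unique (realises-cong (realises-· realises-g realises-h) (λ q → δ0∘rotate1) refl) realises-b

  hᵢ[s∸1]·hᵢ[M∸1]≈a : hᵢ (s ∸ 1) · hᵢ (M ∸ 1) ≈ a
  hᵢ[s∸1]·hᵢ[M∸1]≈a = realises-unique
    (realises-cong (realises-· (realises-hᵢ s∸1<M) (realises-hᵢ (pred<self M)))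
                   (λ q q<M → cong (λ r → δ (s ∸ 1) q ℙ.+ δ (M ∸ 1) r) (rotate-zero q<M)) refl)
    realises-a

  R⊆G : ∀ {x} → R x → G x
  R⊆G = ⟨⟩-minimal (⟨⟩-isSubgroup _) generators
    where
    open IsSubgroup (⟨⟩-isSubgroup (h ∷ g ∷ []))
    hᵢ∈G : ∀ i → G (hᵢ i)
    hᵢ∈G i = conj-closed (gen (here refl)) (pow-closed (gen (there (here refl))) i)
    generators : ∀ {x} → x ∈ a ∷ b ∷ [] → G x
    generators (here refl)         = ≈-closed hᵢ[s∸1]·hᵢ[M∸1]≈a (·-closed (hᵢ∈G (s ∸ 1)) (hᵢ∈G (M ∸ 1)))
    generators (there (here refl)) = ≈-closed g·h≈b (·-closed (gen (there (here refl))) (gen (here refl)))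

  data Position (q : ℕ) : Set where
    low       : suc q < s → Position q
    low-last  : suc q ≡ s → Position q
    high      : s ≤ q → suc q < M → Position q
    high-last : suc q ≡ M → Position q

  position : ∀ {q} → q < M → Position q
  position {q} q<M with q <? s
  ... | yes q<s with successor s q<s
  ...   | inner q+1<s = low q+1<s
  ...   | last  q+1≡s = low-last q+1≡s
  position {q} q<M | no q≮s with successor M q<M
  ...   | inner q+1<M = high (≮⇒≥ q≮s) q+1<M
  ...   | last  q+1≡M = high-last q+1≡M

  Vₐ-vanishes : ∀ {q} → q ≢ s ∸ 1 → q ≢ M ∸ 1 → Vₐ q ≡ 0ℙ
  Vₐ-vanishes q≢s∸1 q≢M∸1 rewrite δ-other q≢s∸1 | δ-other q≢M∸1 = refl

  Vₐ-s∸1 : Vₐ (s ∸ 1) ≡ 1ℙ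
  Vₐ-s∸1 rewrite δ-self (s ∸ 1) | δ-other s∸1≢M∸1 = refl

  Vₐ-M∸1 : Vₐ (M ∸ 1) ≡ 1ℙ
  Vₐ-M∸1 rewrite δ-self (M ∸ 1) | δ-other (s∸1≢M∸1 ∘ sym) = refl

  -- that is, D is trivial or the sign vector of a
  periodic-support : ∀ (D : Signs) → (∀ {q} → q < M → D q ≡ D ((q + s) % M)) → (∀ {q} → s ≤ q → suc q < M → D q ≡ 0ℙ) →
                     ∀ {q} → q < M → D q ≡ D (M ∸ 1) ℙ.* Vₐ q
  periodic-support D periodic upper {q} q<M with position q<M
  ... | low q+1<s rewrite Vₐ-vanishes (≢pred s q+1<s) (≢pred M (<-trans q+1<s s<M)) | ℙ.*-zeroʳ (D (M ∸ 1)) =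
    trans (periodic q<M) (trans (cong D ([q+s]%M≡q+s (<-trans (n<1+n q) q+1<s))) (upper (m≤n+m s q) (q+s<M q+1<s)))
  ... | high s≤q q+1<M
    rewrite Vₐ-vanishes (λ q≡ → <⇒≱ (subst (_< s) (sym q≡) (pred<self s)) s≤q) (≢pred M q+1<M) | ℙ.*-zeroʳ (D (M ∸ 1)) =
    upper s≤q q+1<M
  ... | low-last q+1≡s rewrite cong pred q+1≡s | Vₐ-s∸1 | ℙ.*-identityʳ (D (M ∸ 1)) =
    trans (periodic s∸1<M) (cong D (trans ([q+s]%M≡q+s (pred<self s)) s∸1+s≡M∸1))
  ... | high-last q+1≡M rewrite cong pred q+1≡M | Vₐ-M∸1 | ℙ.*-identityʳ (D (M ∸ 1)) = refl

  UpperTrivial : Signs → Set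
  UpperTrivial σ = ∀ {q} → s ≤ q → q < M → σ q ≡ 0ℙ

  LowerFlip : Perm N → Set
  LowerFlip x = ∃ λ σ → Realises x σ 0 × UpperTrivial σ

  lowerFlip-isSubgroup : IsSubgroup LowerFlip
  lowerFlip-isSubgroup = record
    { e-closed  = _ , realises-e , λ _ _ → refl
    ; ·-closed  = λ (σ , rx , σ↑) (τ , ry , τ↑) → _ , realises-· rx ry ,
                    λ s≤q q<M → cong₂ ℙ._+_ (σ↑ s≤q q<M) (trans (cong τ (rotate-zero q<M)) (τ↑ s≤q q<M))
    ; ⁻¹-closed = λ (σ , rx , σ↑) → σ , realises-⁻¹₀ rx , σ↑
    ; ≈-closed  = λ x≈y (σ , rx , σ↑) → σ , realises-resp x≈y rx , σ↑
    }

  H⊆lowerFlip : ∀ {x} → H x → LowerFlip x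
  H⊆lowerFlip = ⟨⟩-minimal lowerFlip-isSubgroup generator
    where
    generator : ∀ {x} → x ∈ applyUpTo hᵢ s → LowerFlip x
    generator x∈ with ∈-applyUpTo⁻ hᵢ x∈
    ... | i , i<s , refl = δ i , realises-hᵢ (<-trans i<s s<M) , λ s≤q _ → δ-other (λ q≡i → <⇒≱ i<s (subst (s ≤_) q≡i s≤q))

  lowerFlip-in-H : ∀ {σ} → UpperTrivial σ → ∃ λ x → H x × Realises x σ 0
  lowerFlip-in-H {σ} σ↑ = product σ hᵢ s ,
    product-closed (⟨⟩-isSubgroup _) σ hᵢ s (gen ∘ ∈-applyUpTo⁺ hᵢ) ,
    realises-cong (realises-product σ hᵢ s (realises-hᵢ ∘ (λ j<s → <-trans j<s s<M))) sifted refl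
    where
    sifted : ∀ q → q < M → ∑ s (λ j → σ j ℙ.* δ j q) ≡ σ q
    sifted q q<M with q <? s
    ... | yes q<s = ∑-sift-< s σ q<s
    ... | no  q≮s = trans (∑-sift-≥ s σ (≮⇒≥ q≮s)) (sym (σ↑ (≮⇒≥ q≮s) q<M))

  H∩centraliser-trivial : ∀ {x} → H x → Commutes bˢ x → x ≈ e
  H∩centraliser-trivial hx x↔bˢ with H⊆lowerFlip hx
  ... | σ , rx , σ↑ = realises-unique rx (realises-cong realises-e (λ q q<M → sym (vanishes q<M)) refl)
    where
    vanishes : ∀ {q} → q < M → σ q ≡ 0ℙ
    vanishes {q} q<M =
      trans (periodic-support σ (commutes⇒periodic rx realises-bˢ x↔bˢ) (λ s≤q q+1<M → σ↑ s≤q (<-trans (n<1+n _) q+1<M)) q<M)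
            (cong (ℙ._* Vₐ q) (σ↑ (subst (s ≤_) s∸1+s≡M∸1 (m≤n+m s (s ∸ 1))) (pred<self M)))

  R-coset-representative-unique : ∀ {x y} → R x → R y → RightCoset H y x → x ≈ y
  R-coset-representative-unique {x} {y} x∈R y∈R (z , z∈H , x≈z·y) p = trans (x≈z·y p) (cong (y ⟨$⟩ʳ_) (z≈e p))
    where
    open IsSubgroup (commutes-isSubgroup bˢ)
    z≈e : z ≈ e
    z≈e = H∩centraliser-trivial z∈H (≈-closed (x≈z·y⇒x·y⁻¹≈z {x = x} {y} {z} x≈z·y)
                                               (·-closed (R-centralises-bˢ x∈R) (⁻¹-closed (R-centralises-bˢ y∈R))))

  record HR-Factorisation (x : Perm N) : Set where
    constructor factorisation
    field
      {h₀ r} : Perm N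
      h₀∈H   : H h₀
      r∈R    : R r
      x≈h₀·r : x ≈ h₀ · r

  -- the witness is (∏ⱼ cⱼ ^ wⱼ) bᵏ, where wⱼ corrects the sign of bᵏ on block s + j
  R-realises-upper-signs : ∀ (σ : Signs) k → ∃₂ λ r τ → R r × Realises r τ k × (∀ {q} → s ≤ q → q < M → τ q ≡ σ q)
  R-realises-upper-signs σ k = product w cⱼ s · pow b k , ρ ⊕ u , r∈R , rr , τ-upper
    where
    u : Signs
    u = proj₁ (realises-pow realises-b k)
    w : ℕ → Parity
    w j = σ (s + j) ℙ.+ u (s + j)
    ρ : Signs
    ρ q = ∑ s (λ j → w j ℙ.* (δ (s + j) ⊕ δ j) q)
    open IsSubgroup (⟨⟩-isSubgroup (a ∷ b ∷ []))
    b∈R : R b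
    b∈R = gen (there (here refl))
    r∈R : R (product w cⱼ s · pow b k)
    r∈R = ·-closed (product-closed (⟨⟩-isSubgroup _) w cⱼ s (λ {j} _ → conj-closed (gen (here refl)) (pow-closed b∈R (suc j))))
                   (pow-closed b∈R k)
    rr : Realises (product w cⱼ s · pow b k) (ρ ⊕ u) k
    rr = realises-cong (realises-· (realises-product w cⱼ s realises-cⱼ) (proj₂ (realises-pow realises-b k)))
                       (λ q q<M → cong (λ t → ρ q ℙ.+ u t) (rotate-zero q<M)) refl
    τ-upper : ∀ {q} → s ≤ q → q < M → ρ q ℙ.+ u q ≡ σ q
    τ-upper {q} s≤q q<M = begin
      ρ q ℙ.+ u q                                ≡⟨ cong (ℙ._+ u q) (∑-cong s (λ j<s → cong (w _ ℙ.*_) (upper-δ j<s))) ⟩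
      ∑ s (λ j → w j ℙ.* δ j (q ∸ s)) ℙ.+ u q    ≡⟨ cong (ℙ._+ u q) (∑-sift-< s w q∸s<s) ⟩
      w (q ∸ s) ℙ.+ u q                          ≡⟨ cong (λ t → σ t ℙ.+ u t ℙ.+ u q) (m+[n∸m]≡n s≤q) ⟩
      σ q ℙ.+ u q ℙ.+ u q                        ≡⟨ p+q+q≡p (σ q) (u q) ⟩
      σ q                                        ∎
      where
      open ≡-Reasoning
      upper-δ : ∀ {j} → j < s → (δ (s + j) ⊕ δ j) q ≡ δ j (q ∸ s)
      upper-δ j<s = trans (cong₂ ℙ._+_ (δ-+ _ s≤q) (δ-other (λ q≡j → <⇒≱ j<s (subst (s ≤_) q≡j s≤q)))) (ℙ.+-identityʳ _)
      q∸s<s : q ∸ s < s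
      q∸s<s = +-cancelˡ-< s _ _ (subst₂ _<_ (sym (m+[n∸m]≡n s≤q)) M≡s+s q<M)

  wreath-factorisation : ∀ {x σ k} → Realises x σ k → HR-Factorisation x
  wreath-factorisation {x} {σ} {k} rx = via-R (R-realises-upper-signs σ k)
    where
    via-R : (∃₂ λ r τ → R r × Realises r τ k × (∀ {q} → s ≤ q → q < M → τ q ≡ σ q)) → HR-Factorisation x
    via-R (r , τ , r∈R , rr , τ≡σ) = via-H (lowerFlip-in-H upper)
      where
      upper : UpperTrivial (σ ⊕ τ)
      upper {q} s≤q q<M = trans (cong (σ q ℙ.+_) (τ≡σ s≤q q<M)) (ℙ.p+p≡0ℙ (σ q))
      via-H : (∃ λ z → H z × Realises z (σ ⊕ τ) 0) → HR-Factorisation x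
      via-H (z , z∈H , rz) = factorisation z∈H r∈R (x·y⁻¹≈z⇒x≈z·y {x = x} {r} {z} (realises-unique (realises-/ rx rr) rz))

  G-factorisation : ∀ {x} → G x → HR-Factorisation x
  G-factorisation x∈G = wreath-factorisation (proj₂ (proj₂ (G⊆wreath x∈G)))

  hᵢ∈H : ∀ {i} → i < s → H (hᵢ i)
  hᵢ∈H i<s = gen (∈-applyUpTo⁺ hᵢ i<s)

  hᵢ[s∸1]·g·e≈a·b : hᵢ (s ∸ 1) · g · e ≈ a · b
  hᵢ[s∸1]·g·e≈a·b = realises-unique
    (realises-cong (realises-· (realises-· (realises-hᵢ s∸1<M) realises-g) realises-e)
                   (λ q _ → trans (ℙ.+-identityʳ _) (ℙ.+-identityʳ _)) refl)
    (realises-cong (realises-· realises-a realises-b) signs refl)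
    where
    signs : ∀ q → q < M → Vₐ q ℙ.+ δ (M ∸ 1) ((q + 0) % M) ≡ δ (s ∸ 1) q
    signs q q<M rewrite rotate-zero q<M = p+q+q≡p (δ (s ∸ 1) q) (δ (M ∸ 1) q)

  e·g·hᵢ[0]≈b : e · g · hᵢ 0 ≈ b
  e·g·hᵢ[0]≈b = realises-unique
    (realises-cong (realises-· (realises-· realises-e realises-g) (realises-hᵢ 0<M)) (λ q → δ0∘rotate1) refl)
    realises-b

  S⊆HgH : ∀ {z} → S z → DoubleCoset H g z
  S⊆HgH (inj₁ z≈a·b) = hᵢ (s ∸ 1) , e , hᵢ∈H (pred<self s) , one , λ p → trans (z≈a·b p) (sym (hᵢ[s∸1]·g·e≈a·b p))
  S⊆HgH (inj₂ z≈b)   = e , hᵢ 0 , one , hᵢ∈H 0<s , λ p → trans (z≈b p) (sym (e·g·hᵢ[0]≈b p))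

  -- z b⁻¹ is a sign change commuting with bˢ and supported on the first s blocks and the last one
  HgH∩centraliser⊆S : ∀ {z} → DoubleCoset H g z → Commutes bˢ z → S z
  HgH∩centraliser⊆S {z} (h₁ , h₂ , h₁∈H , h₂∈H , z≈h₁gh₂) z↔bˢ with H⊆lowerFlip h₁∈H | H⊆lowerFlip h₂∈H
  ... | w₁ , r₁ , w₁↑ | w₂ , r₂ , w₂↑ = decide (D (M ∸ 1)) refl
    where
    W D : Signs
    W q = w₁ q ℙ.+ w₂ ((q + 1) % M)
    D = W ⊕ δ (M ∸ 1)
    rz : Realises z W 1
    rz = realises-cong (realises-resp (λ p → sym (z≈h₁gh₂ p)) (realises-· (realises-· r₁ realises-g) r₂))
                       (λ q _ → cong (ℙ._+ w₂ ((q + 1) % M)) (ℙ.+-identityʳ (w₁ q))) refl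
    ry : Realises (z · b ⁻¹) D 0
    ry = realises-/ rz realises-b
    open IsSubgroup (commutes-isSubgroup bˢ)
    upper : ∀ {q} → s ≤ q → suc q < M → D q ≡ 0ℙ
    upper {q} s≤q q+1<M rewrite w₁↑ s≤q (<-trans (n<1+n q) q+1<M) | [q+1]%M-inner M q+1<M
                              | w₂↑ (≤-trans s≤q (n≤1+n q)) q+1<M | δ-other (≢pred M q+1<M) = refl
    support : ∀ {q} → q < M → D q ≡ D (M ∸ 1) ℙ.* Vₐ q
    support = periodic-support D (commutes⇒periodic ry realises-bˢ (·-closed z↔bˢ (⁻¹-closed (pow-commutes b s)))) upper
    decide : ∀ p → D (M ∸ 1) ≡ p → S z
    decide 0ℙ eq = inj₂ (x·y⁻¹≈z⇒x≈z·y {x = z} {b} {e}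
                     (realises-unique ry (realises-cong realises-e (λ q q<M → sym (trans (support q<M) (cong (ℙ._* Vₐ q) eq))) refl)))
    decide 1ℙ eq = inj₁ (x·y⁻¹≈z⇒x≈z·y {x = z} {b} {a}
                     (realises-unique ry (realises-cong realises-a (λ q q<M → sym (trans (support q<M) (cong (ℙ._* Vₐ q) eq))) refl)))

  H-isSubgroup : IsSubgroup H
  H-isSubgroup = ⟨⟩-isSubgroup _

  module _ {x : Perm N} (x∈G : G x) where
    open HR-Factorisation (G-factorisation x∈G)

    representative : Perm N
    representative = r

    representative∈R : R representative
    representative∈R = r∈R

    representative∈Hx : RightCoset H x representative
    representative∈Hx = rightCoset-sym H-isSubgroup representative x (h₀ , h₀∈H , x≈h₀·r)

  isomorphism : Γ ≅ CosGHgH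
  isomorphism = record
    { to        = λ (x , x∈R) → x , R⊆G x∈R
    ; from      = λ (x , x∈G) → representative x∈G , representative∈R x∈G
    ; to-cong   = λ {(x , _)} {(y , _)} x≈y z → mk⇔ (rightCoset-resp x y z x≈y) (rightCoset-resp y x z (λ p → sym (x≈y p)))
    ; from-cong = λ {(x , x∈G)} {(y , y∈G)} Hx⇔Hy →
        R-coset-representative-unique (representative∈R x∈G) (representative∈R y∈G)
          (Equivalence.from (rightCoset-of-member H-isSubgroup y (representative y∈G) (representative∈Hx y∈G) (representative x∈G))
                            (Equivalence.to (Hx⇔Hy (representative x∈G)) (representative∈Hx x∈G)))
    ; from-to   = λ (x , x∈R) → R-coset-representative-unique (representative∈R (R⊆G x∈R)) x∈R (representative∈Hx (R⊆G x∈R))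
    ; to-from   = λ (y , y∈G) → rightCoset-of-member H-isSubgroup y (representative y∈G) (representative∈Hx y∈G)
    ; arcs      = λ (x , x∈R) (y , y∈R) → mk⇔ (S⊆HgH {y · x ⁻¹}) λ y·x⁻¹∈HgH →
                    HgH∩centraliser⊆S {y · x ⁻¹} y·x⁻¹∈HgH
                      (·-closed (R-centralises-bˢ y∈R) (⁻¹-closed (R-centralises-bˢ x∈R)))
    }
    where open IsSubgroup (commutes-isSubgroup bˢ)

lemma3p2 : (s : ℕ) (s≥2 : 2 ≤ s) →
    Construction.Γ s s≥2 ≅ Construction.CosGHgH s s≥2
lemma3p2 s s≥2 = Lemma3p2.isomorphism s s≥2
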